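{- A binary Steinhaus triangle $(a_{i,j})_{1\le i\le j\le n}$ of size $n$ is horizontally symmetric if and only if $a_{n-2i,n-i}=0$ for all $i\in\{0,\dots,\lfloor\frac n2\rfloor-1\}$.
   Context: A binary Steinhaus triangle of size $n$ is an array $(a_{i,j})_{1\le i\le j\le n}$ of elements of $\{0,1\}$ with $a_{i,j}\equiv a_{i-1,j-1}+a_{i-1,j}\pmod 2$ for $2\le i\le j\le n$. It is horizontally symmetric if it is fixed by $h((a_{i,j}))=(a_{i,n-j+i})_{1\le i\le j\le n}$, i.e. $a_{i,j}=a_{i,n-j+i}$ for all $1\le i\le j\le n$. -}

module Defs where

open import Data.Nat using (ℕ; _+_; _∸_; _≤_)
open import Data.Bool using (Bool; _xor_)
open import Data.Product using (_×_)
open import Relation.Binary.PropositionalEquality using (_≡_)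

-- An array (a_{i,j}) of elements of {0,1} = Bool (false = 0, true = 1),
-- represented as a function on ℕ × ℕ; only entries with 1 ≤ i ≤ j ≤ n matter.
Array : Set
Array = ℕ → ℕ → Bool

IsSteinhaus : ℕ → Array → Set
IsSteinhaus n a = ∀ i j → 2 ≤ i → i ≤ j → j ≤ n →
  a i j ≡ (a (i ∸ 1) (j ∸ 1) xor a (i ∸ 1) j)

HSymmetric : ℕ → Array → Set
HSymmetric n a = ∀ i j → 1 ≤ i → i ≤ j → j ≤ n → a i j ≡ a i ((n ∸ j) + i)

module Submission where

-- Write row r (1 ≤ r ≤ n) with offsets: its entries are a r (r + p), and the
-- offsets p, q are mirror images when r + p + q = n.  Row r is symmetric iff
-- every defect  a r (r + p) xor a r (r + q)  at a mirror pair vanishes.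
--
-- (1) If row r + 1 is symmetric, the Steinhaus rule shows that the defect of
--     row r does not change when the mirror pair (p, q + 1) moves to (p + 1, q);
--     hence all defects of row r are equal to the defect at its middle.
-- (2) If the row has an odd number of entries the middle pair is (h, h) and its
--     defect is x xor x = false.  Otherwise the middle pair is (h, h + 1) and,
--     by the Steinhaus rule, its defect is the middle entry of row r + 1.
-- Downward induction on r (the last row is a single entry) therefore shows that
-- vanishing middles make every row symmetric; conversely in a symmetric triangle
-- the middle entry of row r + 1 is x xor x for the middle pair x, x of row r.
-- The criterion a (n ∸ 2i) (n ∸ i) = false for i < ⌊n/2⌋ is exactly the
-- statement that the middle entry of row r = n ∸ 2i ≥ 2 vanishes.

open import Defs
open import Data.Nat using (ℕ; zero; suc; _+_; _∸_; _*_; _≤_; _<_; _/_; z≤n; s≤s)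
open import Data.Nat.Properties
  using (≤-trans; m≤m+n; +-suc; +-assoc; +-comm; +-cancelˡ-≡; *-monoˡ-≤;
         m+n∸m≡n; m+[n∸m]≡n; m≤n⇒∃[o]m+o≡n)
open import Data.Nat.DivMod using (m*n/n≡m; m/n*n≤m; /-monoˡ-≤)
open import Data.Nat.Tactic.RingSolver using (solve-∀)
open import Data.Bool using (Bool; true; false; _xor_)
open import Data.Bool.Properties using (xor-same)
open import Data.Product using (∃; _,_)
open import Data.Sum using (_⊎_; inj₁; inj₂)
open import Function.Bundles using (_⇔_; mk⇔; Equivalence)
open import Relation.Binary.PropositionalEquality
  using (_≡_; refl; sym; trans; cong; cong₂; subst; module ≡-Reasoning)

open Equivalence using (to; from)

xor-exchange : ∀ x y z w → x xor y ≡ z xor w → x xor w ≡ y xor z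
xor-exchange false false false false refl = refl
xor-exchange false false true  true  refl = refl
xor-exchange false true  false true  refl = refl
xor-exchange false true  true  false refl = refl
xor-exchange true  false false true  refl = refl
xor-exchange true  false true  false refl = refl
xor-exchange true  true  false false refl = refl
xor-exchange true  true  true  true  refl = refl
xor-exchange false false false true  ()
xor-exchange false false true  false ()
xor-exchange false true  false false ()
xor-exchange false true  true  true  ()
xor-exchange true  false false false ()
xor-exchange true  false true  true  ()
xor-exchange true  true  false true  ()
xor-exchange true  true  true  false ()

xor≡false⇒≡ : ∀ x y → x xor y ≡ false → x ≡ y
xor≡false⇒≡ false false _ = refl
xor≡false⇒≡ true  true  _ = refl
xor≡false⇒≡ false true  ()
xor≡false⇒≡ true  false ()

∸-from-+ : ∀ {n m k} → n ≡ m + k → n ∸ m ≡ k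
∸-from-+ {m = m} {k} refl = m+n∸m≡n m k

≤-from-+ : ∀ {n m k} → m + k ≡ n → m ≤ n
≤-from-+ {m = m} {k} refl = m≤m+n m k

even-or-odd : ∀ m → ∃ λ h → m ≡ h + h ⊎ m ≡ suc (h + h)
even-or-odd zero = 0 , inj₁ refl
even-or-odd (suc m) with even-or-odd m
... | h , inj₁ e = h , inj₂ (cong suc e)
... | h , inj₂ e = suc h , inj₁ (cong suc (trans e (sym (+-suc h h))))

<half⇒ : ∀ {i n} → i < n / 2 → suc i * 2 ≤ n
<half⇒ {i} {n} i<n/2 = ≤-trans (*-monoˡ-≤ 2 i<n/2) (m/n*n≤m n 2)

⇒<half : ∀ {i n} → suc i * 2 ≤ n → i < n / 2
⇒<half {i} {n} le = subst (_≤ n / 2) (m*n/n≡m (suc i) 2) (/-monoˡ-≤ 2 le)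

module Rows (n : ℕ) (a : Array) where

  RowSymmetric : ℕ → Set
  RowSymmetric r = ∀ p q → r + p + q ≡ n → a r (r + p) ≡ a r (r + q)

  MiddlesVanish : Set
  MiddlesVanish = ∀ r h → 2 ≤ r → r + h + h ≡ n → a r (r + h) ≡ false

  offset-sum : ∀ r p q {m} → r + p + q ≡ n → r + m ≡ n → p + q ≡ m
  offset-sum r p q pair length =
    +-cancelˡ-≡ r _ _ (trans (sym (+-assoc r p q)) (trans pair (sym length)))

  hsym⇔rows : HSymmetric n a ⇔ (∀ r → 1 ≤ r → RowSymmetric r)
  hsym⇔rows = mk⇔ rows hsym
    where
    rows : HSymmetric n a → ∀ r → 1 ≤ r → RowSymmetric r
    rows hs r 1≤r p q pair =
      trans (hs r (r + p) 1≤r (m≤m+n r p) (≤-from-+ pair))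
        (cong (a r) (trans (cong (_+ r) (∸-from-+ (sym pair))) (+-comm q r)))
    hsym : (∀ r → 1 ≤ r → RowSymmetric r) → HSymmetric n a
    hsym rs i j 1≤i i≤j j≤n =
      trans (cong (a i) (sym (m+[n∸m]≡n i≤j)))
        (trans (rs i 1≤i (j ∸ i) (n ∸ j) pair) (cong (a i) (+-comm i (n ∸ j))))
      where
      pair : i + (j ∸ i) + (n ∸ j) ≡ n
      pair = trans (cong (_+ (n ∸ j)) (m+[n∸m]≡n i≤j)) (m+[n∸m]≡n j≤n)

  criterion⇔middles :
    (∀ i → i < n / 2 → a (n ∸ 2 * i) (n ∸ i) ≡ false) ⇔ MiddlesVanish
  criterion⇔middles = mk⇔ middles criterion
    where
    middle-entry : ∀ r h → r + h + h ≡ n → a (n ∸ 2 * h) (n ∸ h) ≡ a r (r + h)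
    middle-entry r h length =
      cong₂ a (∸-from-+ {m = 2 * h} (trans (sym length) (rows-below r h)))
              (∸-from-+ {m = h} (trans (sym length) (+-comm (r + h) h)))
      where
      rows-below : ∀ r h → r + h + h ≡ 2 * h + r
      rows-below = solve-∀
    middles : (∀ i → i < n / 2 → a (n ∸ 2 * i) (n ∸ i) ≡ false) → MiddlesVanish
    middles c r@(suc (suc t)) h (s≤s (s≤s z≤n)) length =
      trans (sym (middle-entry r h length))
        (c h (⇒<half (≤-from-+ (trans (shape t h) length))))
      where
      shape : ∀ t h → suc h * 2 + t ≡ suc (suc t) + h + h
      shape = solve-∀
    criterion : MiddlesVanish → ∀ i → i < n / 2 → a (n ∸ 2 * i) (n ∸ i) ≡ false
    criterion mv i i<n/2 with m≤n⇒∃[o]m+o≡n (<half⇒ i<n/2)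
    ... | t , sum = trans (middle-entry (suc (suc t)) i length)
                      (mv (suc (suc t)) i (s≤s (s≤s z≤n)) length)
      where
      shape : ∀ t i → suc (suc t) + i + i ≡ suc i * 2 + t
      shape = solve-∀
      length : suc (suc t) + i + i ≡ n
      length = trans (shape t i) sum

  module Triangle (st : IsSteinhaus n a) where

    defect : ℕ → ℕ → ℕ → Bool
    defect r p q = a r (r + p) xor a r (r + q)

    rule : ∀ r p → 1 ≤ r → suc (r + p) ≤ n →
      a (suc r) (suc (r + p)) ≡ a r (r + p) xor a r (r + suc p)
    rule r p 1≤r below =
      trans (st (suc r) (suc (r + p)) (s≤s 1≤r) (s≤s (m≤m+n r p)) below)
        (cong (λ j → a r (r + p) xor a r j) (sym (+-suc r p)))

    defect-shift : ∀ r p q → 1 ≤ r → RowSymmetric (suc r) → r + p + suc q ≡ n →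
      defect r p (suc q) ≡ defect r (suc p) q
    defect-shift r p q 1≤r below-symmetric pair =
      xor-exchange (a r (r + p)) (a r (r + suc p)) (a r (r + q)) (a r (r + suc q)) (begin
        a r (r + p) xor a r (r + suc p)   ≡⟨ sym (rule r p 1≤r (≤-from-+ {k = q} pair-p)) ⟩
        a (suc r) (suc (r + p))           ≡⟨ below-symmetric p q pair-below ⟩
        a (suc r) (suc (r + q))           ≡⟨ rule r q 1≤r (≤-from-+ {k = p} pair-q) ⟩
        a r (r + q) xor a r (r + suc q)   ∎)
      where
      open ≡-Reasoning
      pair-below : suc r + p + q ≡ n
      pair-below = trans (sym (+-suc (r + p) q)) pair
      pair-p : suc (r + p) + q ≡ n
      pair-p = pair-below
      swap : ∀ r p q → suc (r + q) + p ≡ r + p + suc q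
      swap = solve-∀
      pair-q : suc (r + q) + p ≡ n
      pair-q = trans (swap r p q) pair

    defect-constant : ∀ r p q → 1 ≤ r → RowSymmetric (suc r) → r + p + q ≡ n →
      defect r p q ≡ defect r 0 (p + q)
    defect-constant r zero q _ _ _ = refl
    defect-constant r (suc p) q 1≤r below-symmetric pair = begin
      defect r (suc p) q      ≡⟨ sym (defect-shift r p q 1≤r below-symmetric pair′) ⟩
      defect r p (suc q)      ≡⟨ defect-constant r p (suc q) 1≤r below-symmetric pair′ ⟩
      defect r 0 (p + suc q)  ≡⟨ cong (defect r 0) (+-suc p q) ⟩
      defect r 0 (suc p + q)  ∎
      where
      open ≡-Reasoning
      pair′ : r + p + suc q ≡ n
      pair′ = trans (+-suc (r + p) q) (trans (cong (_+ q) (sym (+-suc r p))) pair)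

    defects-agree : ∀ r p q p′ q′ → 1 ≤ r → RowSymmetric (suc r) →
      r + p + q ≡ n → r + p′ + q′ ≡ n → defect r p q ≡ defect r p′ q′
    defects-agree r p q p′ q′ 1≤r below-symmetric pair pair′ =
      trans (defect-constant r p q 1≤r below-symmetric pair)
        (trans (cong (defect r 0) (offset-sum r p q pair (trans (sym (+-assoc r p′ q′)) pair′)))
          (sym (defect-constant r p′ q′ 1≤r below-symmetric pair′)))

    row-step : ∀ r m → 1 ≤ r → r + m ≡ n → RowSymmetric (suc r) → MiddlesVanish →
      RowSymmetric r
    row-step r m 1≤r length below-symmetric mv p q pair =
      xor≡false⇒≡ (a r (r + p)) (a r (r + q)) (middle-defect (even-or-odd m))
      where
      pair-at : ∀ {p′ q′} → m ≡ p′ + q′ → r + p′ + q′ ≡ n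
      pair-at {p′} {q′} split =
        trans (+-assoc r p′ q′) (trans (cong (r +_) (sym split)) length)
      middle-defect : (∃ λ h → m ≡ h + h ⊎ m ≡ suc (h + h)) → defect r p q ≡ false
      middle-defect (h , inj₁ even) =
        trans (defects-agree r p q h h 1≤r below-symmetric pair (pair-at even))
          (xor-same (a r (r + h)))
      middle-defect (h , inj₂ odd) =
        trans (defects-agree r p q h (suc h) 1≤r below-symmetric pair middle-pair)
          (trans (sym (rule r h 1≤r (≤-from-+ {k = h} middle-length)))
            (mv (suc r) h (s≤s 1≤r) middle-length))
        where
        middle-pair : r + h + suc h ≡ n
        middle-pair = pair-at (trans odd (sym (+-suc h h)))
        middle-length : suc r + h + h ≡ n
        middle-length = trans (sym (+-suc (r + h) h)) middle-pair

    rows-symmetric : MiddlesVanish → ∀ m r → 1 ≤ r → r + m ≡ n → RowSymmetric r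
    rows-symmetric mv zero r _ length p q pair =
      single-entry p q (offset-sum r p q pair length)
      where
      single-entry : ∀ p q → p + q ≡ 0 → a r (r + p) ≡ a r (r + q)
      single-entry zero zero _ = refl
      single-entry zero (suc q) ()
      single-entry (suc p) q ()
    rows-symmetric mv (suc m) r 1≤r length =
      row-step r (suc m) 1≤r length
        (rows-symmetric mv m (suc r) (s≤s z≤n) (trans (sym (+-suc r m)) length)) mv

    -- Rows beyond n have no mirror pairs, so every row is symmetric.
    all-rows-symmetric : MiddlesVanish → ∀ r → 1 ≤ r → RowSymmetric r
    all-rows-symmetric mv r 1≤r p q pair =
      rows-symmetric mv (n ∸ r) r 1≤r (m+[n∸m]≡n r≤n) p q pair
      where
      r≤n : r ≤ n
      r≤n = ≤-trans (m≤m+n r p) (≤-from-+ {k = q} pair)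

    -- Conversely, in a symmetric triangle the middle entry of row r + 1 is the
    -- sum of the two equal middle entries of row r.
    middles-vanish : (∀ r → 1 ≤ r → RowSymmetric r) → MiddlesVanish
    middles-vanish rows (suc r) h (s≤s 1≤r) length =
      trans (rule r h 1≤r (≤-from-+ {k = h} length))
        (trans (cong (_xor a r (r + suc h)) (rows r 1≤r h (suc h) middle-pair))
          (xor-same (a r (r + suc h))))
      where
      middle-pair : r + h + suc h ≡ n
      middle-pair = trans (+-suc (r + h) h) length

mainTheorem17 : (n : ℕ) (a : Array) → IsSteinhaus n a →
    HSymmetric n a ⇔ (∀ i → i < n / 2 → a (n ∸ 2 * i) (n ∸ i) ≡ false)
mainTheorem17 n a st = mk⇔
  (λ symmetric → from criterion⇔middles (middles-vanish (to hsym⇔rows symmetric)))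
  (λ criterion → from hsym⇔rows (all-rows-symmetric (to criterion⇔middles criterion)))
  where
  open Rows n a
  open Triangle st
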